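{- Let $(X,*,\to,e)$ be an algebra with binary operations $*,\to$ and constant $e$ satisfying, for all $x,y$: $x\to x=e$, $e\to x=x$, and $((x\to y)\to y)*(((x\to y)\to y)\to x)=x$ (a Johnstone algebra). Define $x\le y$ iff $x\to y=e$. \begin{enumerate} \item If $X$ satisfies Residuation $x\to(y\to z)=(y*x)\to z$, then $\le$ is a partial order on $X$ and $(X,*,e)$ is a monoid. Moreover, an algebra $(X,*,\to,e)$ satisfying the left loop axioms satisfies Residuation if and only if $(X,*,e)$ is a group. \item If $X$ satisfies Compositionality $(x\to y)\to((z\to x)\to(z\to y))=e$, then $\le$ is a partial order on $X$ and $\to$ is increasing in its second argument ($y\le z$ implies $(x\to y)\le(x\to z)$). Moreover, an algebra $(X,*,\to,e)$ satisfying the left loop axioms satisfies Compositionality if and only if $(X,*,e)$ is a group. \item If $X$ satisfies both Residuation and Compositionality, then for each $x\in X$ and all $y,z\in X$: $x*y\le z$ iff $y\le x\to z$; consequently $*$ is increasing in its right argument. \item If $X$ satisfies $x*y=y*x$, Residuation and Compositionality, then $X$ satisfies $x\to(y\to z)=y\to(x\to z)$ and $x\to((x\to y)\to y)=e$; moreover $*$ is increasing in both arguments, and $\to$ is decreasing in its first argument and increasing in its second argument (with respect to $\le$). \end{enumerate}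
   Context: An algebra $(X,*,\to,e)$ satisfies the left loop axioms if for all $x,y$: $x*(x\to y)=y$, $x\to(x*y)=y$, $x*e=x$ and $e*x=x$. (Such algebras satisfy the Johnstone algebra axioms.) -}

module Defs where

open import Level using (Level; suc)
open import Data.Product using (_×_; ∃)
open import Relation.Binary.PropositionalEquality using (_≡_)
open import Relation.Binary.Structures using (IsPartialOrder)
open import Algebra.Structures using (IsMonoid; IsGroup)
open import Function.Bundles using (_⇔_)

record Alg (a : Level) : Set (suc a) where
  infixr 5 _⇒_
  infixl 7 _*_
  field
    X   : Set a
    _*_ : X → X → X
    _⇒_ : X → X → X
    e   : X

module _ {a : Level} (A : Alg a) where
  open Alg A

  IsJohnstone : Set a
  IsJohnstone =
      (∀ x → x ⇒ x ≡ e)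
    × (∀ x → e ⇒ x ≡ x)
    × (∀ x y → ((x ⇒ y) ⇒ y) * (((x ⇒ y) ⇒ y) ⇒ x) ≡ x)

  IsLeftLoop : Set a
  IsLeftLoop =
      (∀ x y → x * (x ⇒ y) ≡ y)
    × (∀ x y → x ⇒ (x * y) ≡ y)
    × (∀ x → x * e ≡ x)
    × (∀ x → e * x ≡ x)

  _≤_ : X → X → Set a
  x ≤ y = x ⇒ y ≡ e

  Residuation : Set a
  Residuation = ∀ x y z → x ⇒ (y ⇒ z) ≡ (y * x) ⇒ z

  Compositionality : Set a
  Compositionality = ∀ x y z → (x ⇒ y) ⇒ ((z ⇒ x) ⇒ (z ⇒ y)) ≡ e

  Commutative* : Set a
  Commutative* = ∀ x y → x * y ≡ y * x

  IsMonoidAlg : Set a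
  IsMonoidAlg = IsMonoid _≡_ _*_ e

  IsGroupAlg : Set a
  IsGroupAlg = ∃ λ (inv : X → X) → IsGroup _≡_ _*_ e inv

  IsPartialOrderAlg : Set a
  IsPartialOrderAlg = IsPartialOrder _≡_ _≤_

  ⇒-IncreasingRight : Set a
  ⇒-IncreasingRight = ∀ x y z → y ≤ z → (x ⇒ y) ≤ (x ⇒ z)

  ⇒-DecreasingLeft : Set a
  ⇒-DecreasingLeft = ∀ x x' y → x ≤ x' → (x' ⇒ y) ≤ (x ⇒ y)

  *-IncreasingRight : Set a
  *-IncreasingRight = ∀ x y z → y ≤ z → (x * y) ≤ (x * z)

  *-IncreasingLeft : Set a
  *-IncreasingLeft = ∀ x y z → x ≤ y → (x * z) ≤ (y * z)

  Part1 : Set a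
  Part1 = (IsJohnstone → Residuation → IsPartialOrderAlg × IsMonoidAlg)
        × (IsLeftLoop → (Residuation ⇔ IsGroupAlg))

  Part2 : Set a
  Part2 = (IsJohnstone → Compositionality → IsPartialOrderAlg × ⇒-IncreasingRight)
        × (IsLeftLoop → (Compositionality ⇔ IsGroupAlg))

  Part3 : Set a
  Part3 = IsJohnstone → Residuation → Compositionality →
            (∀ x y z → ((x * y) ≤ z) ⇔ (y ≤ (x ⇒ z)))
          × *-IncreasingRight

  Part4 : Set a
  Part4 = IsJohnstone → Commutative* → Residuation → Compositionality →
            (∀ x y z → x ⇒ (y ⇒ z) ≡ y ⇒ (x ⇒ z))
          × (∀ x y → x ⇒ ((x ⇒ y) ⇒ y) ≡ e)
          × *-IncreasingLeft × *-IncreasingRight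
          × ⇒-DecreasingLeft × ⇒-IncreasingRight

{-# OPTIONS --safe #-}
-- Johnstone's third axiom, for x ≤ y, says y * (y ⇒ x) = x (as (x ⇒ y) ⇒ y = e ⇒ y = y).
-- This gives antisymmetry and the right unit law, so ≤ is a partial order as soon as it is
-- transitive, and an element u is determined by the map w ↦ u ⇒ w. Residuation makes that
-- map a right action of (X, *), which forces associativity and the left unit law, and also
-- yields transitivity; Compositionality is monotonicity of z ⇒ _, which yields transitivity
-- as well. In a left loop ≤ is equality, so Compositionality collapses to Residuation, and
-- under Residuation x ⇒ e is a two-sided inverse of x.
module Submission where

open import Defs hiding (_≤_)
open import Level using (Level)
open import Data.Product using (_×_; _,_; proj₁; proj₂)
open import Relation.Binary.PropositionalEquality
  using (_≡_; refl; sym; trans; cong; cong₂; subst; subst₂; isEquivalence; module ≡-Reasoning)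
open import Relation.Binary.Definitions using (Transitive)
open import Function.Bundles using (_⇔_; mk⇔; Equivalence)
open import Function.Construct.Composition using (_⇔-∘_)
open import Algebra.Structures using (IsGroup)

open Equivalence using (to; from)

module _ {a : Level} (A : Alg a) where
  open Alg A
  open ≡-Reasoning

  infix 4 _≤_
  _≤_ : X → X → Set a
  _≤_ = Defs._≤_ A

  *-⇒-adjoint : Residuation A → ∀ x y z → (x * y ≤ z) ⇔ (y ≤ x ⇒ z)
  *-⇒-adjoint residuation x y z =
    mk⇔ (trans (residuation y x z)) (trans (sym (residuation y x z)))

  module Johnstone (johnstone : IsJohnstone A) where

    x⇒x≡e : ∀ x → x ⇒ x ≡ e
    x⇒x≡e = proj₁ johnstone

    e⇒x≡x : ∀ x → e ⇒ x ≡ x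
    e⇒x≡x = proj₁ (proj₂ johnstone)

    [x⇒y]⇒y*[[x⇒y]⇒y⇒x]≡x : ∀ x y → ((x ⇒ y) ⇒ y) * (((x ⇒ y) ⇒ y) ⇒ x) ≡ x
    [x⇒y]⇒y*[[x⇒y]⇒y⇒x]≡x = proj₂ (proj₂ johnstone)

    ≤-refl : ∀ {x} → x ≤ x
    ≤-refl {x} = x⇒x≡e x

    ≤-reflexive : ∀ {x y} → x ≡ y → x ≤ y
    ≤-reflexive refl = ≤-refl

    x≤y⇒y*[y⇒x]≡x : ∀ {x y} → x ≤ y → y * (y ⇒ x) ≡ x
    x≤y⇒y*[y⇒x]≡x {x} {y} x≤y = begin
      y * (y ⇒ x)                         ≡⟨ cong (λ u → u * (u ⇒ x)) [x⇒y]⇒y≡y ⟨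
      ((x ⇒ y) ⇒ y) * (((x ⇒ y) ⇒ y) ⇒ x) ≡⟨ [x⇒y]⇒y*[[x⇒y]⇒y⇒x]≡x x y ⟩
      x                                   ∎
      where
      [x⇒y]⇒y≡y : (x ⇒ y) ⇒ y ≡ y
      [x⇒y]⇒y≡y = trans (cong (_⇒ y) x≤y) (e⇒x≡x y)

    *-identityʳ : ∀ x → x * e ≡ x
    *-identityʳ x = subst (λ u → x * u ≡ x) (x⇒x≡e x) (x≤y⇒y*[y⇒x]≡x ≤-refl)

    ≤-antisym : ∀ {x y} → x ≤ y → y ≤ x → x ≡ y
    ≤-antisym {x} {y} x≤y y≤x = begin
      x           ≡⟨ x≤y⇒y*[y⇒x]≡x x≤y ⟨
      y * (y ⇒ x) ≡⟨ cong (y *_) y≤x ⟩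
      y * e       ≡⟨ *-identityʳ y ⟩
      y           ∎

    isPartialOrder : Transitive _≤_ → IsPartialOrderAlg A
    isPartialOrder ≤-trans = record
      { isPreorder = record
        { isEquivalence = isEquivalence
        ; reflexive     = ≤-reflexive
        ; trans         = ≤-trans
        }
      ; antisym = ≤-antisym
      }

    ⇒-extensional : ∀ {u v} → (∀ w → u ⇒ w ≡ v ⇒ w) → u ≡ v
    ⇒-extensional {u} {v} u⇒≗v⇒ =
      ≤-antisym (trans (u⇒≗v⇒ v) (x⇒x≡e v)) (trans (sym (u⇒≗v⇒ u)) (x⇒x≡e u))

  module Residuated (johnstone : IsJohnstone A) (residuation : Residuation A) where
    open Johnstone johnstone

    ≤-trans : Transitive _≤_
    ≤-trans {x} {y} {z} x≤y y≤z = begin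
      x ⇒ z               ≡⟨ cong (_⇒ z) (x≤y⇒y*[y⇒x]≡x x≤y) ⟨
      (y * (y ⇒ x)) ⇒ z   ≡⟨ residuation (y ⇒ x) y z ⟨
      (y ⇒ x) ⇒ (y ⇒ z)   ≡⟨ cong ((y ⇒ x) ⇒_) (trans y≤z (sym (x⇒x≡e y))) ⟩
      (y ⇒ x) ⇒ (y ⇒ y)   ≡⟨ residuation (y ⇒ x) y y ⟩
      (y * (y ⇒ x)) ⇒ y   ≡⟨ cong (_⇒ y) (x≤y⇒y*[y⇒x]≡x x≤y) ⟩
      x ⇒ y               ≡⟨ x≤y ⟩
      e                   ∎

    *-assoc : ∀ x y z → (x * y) * z ≡ x * (y * z)
    *-assoc x y z = ⇒-extensional λ w → begin
      ((x * y) * z) ⇒ w   ≡⟨ residuation z (x * y) w ⟨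
      z ⇒ ((x * y) ⇒ w)   ≡⟨ cong (z ⇒_) (residuation y x w) ⟨
      z ⇒ (y ⇒ (x ⇒ w))   ≡⟨ residuation z y (x ⇒ w) ⟩
      (y * z) ⇒ (x ⇒ w)   ≡⟨ residuation (y * z) x w ⟩
      (x * (y * z)) ⇒ w   ∎

    *-identityˡ : ∀ x → e * x ≡ x
    *-identityˡ x = ⇒-extensional λ w →
      trans (sym (residuation x e w)) (cong (x ⇒_) (e⇒x≡x w))

    isMonoid : IsMonoidAlg A
    isMonoid = record
      { isSemigroup = record
        { isMagma = record { isEquivalence = isEquivalence ; ∙-cong = cong₂ _*_ }
        ; assoc   = *-assoc
        }
      ; identity = *-identityˡ , *-identityʳ
      }

    *-monoʳ-≤ : *-IncreasingRight A
    *-monoʳ-≤ x y z y≤z = from (*-⇒-adjoint residuation x y (x * z))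
      (≤-trans y≤z (to (*-⇒-adjoint residuation x z (x * z)) ≤-refl))

  module Compositional (johnstone : IsJohnstone A) (compositionality : Compositionality A) where
    open Johnstone johnstone

    ⇒-monoʳ-≤ : ⇒-IncreasingRight A
    ⇒-monoʳ-≤ x y z y≤z = begin
      (x ⇒ y) ⇒ (x ⇒ z)             ≡⟨ e⇒x≡x _ ⟨
      e ⇒ ((x ⇒ y) ⇒ (x ⇒ z))       ≡⟨ cong (_⇒ ((x ⇒ y) ⇒ (x ⇒ z))) y≤z ⟨
      (y ⇒ z) ⇒ ((x ⇒ y) ⇒ (x ⇒ z)) ≡⟨ compositionality y z x ⟩
      e                             ∎

    ≤-trans : Transitive _≤_
    ≤-trans {x} {y} {z} x≤y y≤z = begin
      x ⇒ z             ≡⟨ e⇒x≡x (x ⇒ z) ⟨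
      e ⇒ (x ⇒ z)       ≡⟨ cong (_⇒ (x ⇒ z)) x≤y ⟨
      (x ⇒ y) ⇒ (x ⇒ z) ≡⟨ ⇒-monoʳ-≤ x y z y≤z ⟩
      e                 ∎

  module CommutativeResiduated
    (johnstone : IsJohnstone A) (*-comm : Commutative* A) (residuation : Residuation A) where
    open Johnstone johnstone
    open Residuated johnstone residuation

    ⇒-exchange : ∀ x y z → x ⇒ (y ⇒ z) ≡ y ⇒ (x ⇒ z)
    ⇒-exchange x y z = begin
      x ⇒ (y ⇒ z) ≡⟨ residuation x y z ⟩
      (y * x) ⇒ z ≡⟨ cong (_⇒ z) (*-comm y x) ⟩
      (x * y) ⇒ z ≡⟨ residuation y x z ⟨
      y ⇒ (x ⇒ z) ∎

    x≤[x⇒y]⇒y : ∀ x y → x ≤ (x ⇒ y) ⇒ y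
    x≤[x⇒y]⇒y x y = trans (⇒-exchange x (x ⇒ y) y) (x⇒x≡e (x ⇒ y))

    *-monoˡ-≤ : *-IncreasingLeft A
    *-monoˡ-≤ x y z x≤y = subst₂ _≤_ (*-comm z x) (*-comm z y) (*-monoʳ-≤ z x y x≤y)

    ⇒-antimonoˡ-≤ : ⇒-DecreasingLeft A
    ⇒-antimonoˡ-≤ x x′ y x≤x′ =
      trans (⇒-exchange (x′ ⇒ y) x y) (≤-trans x≤x′ (x≤[x⇒y]⇒y x′ y))

  module LeftLoop (leftLoop : IsLeftLoop A) where

    x*[x⇒y]≡y : ∀ x y → x * (x ⇒ y) ≡ y
    x*[x⇒y]≡y = proj₁ leftLoop

    x⇒[x*y]≡y : ∀ x y → x ⇒ (x * y) ≡ y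
    x⇒[x*y]≡y = proj₁ (proj₂ leftLoop)

    *-identityʳ : ∀ x → x * e ≡ x
    *-identityʳ = proj₁ (proj₂ (proj₂ leftLoop))

    *-identityˡ : ∀ x → e * x ≡ x
    *-identityˡ = proj₂ (proj₂ (proj₂ leftLoop))

    x⇒x≡e : ∀ x → x ⇒ x ≡ e
    x⇒x≡e x = trans (cong (x ⇒_) (sym (*-identityʳ x))) (x⇒[x*y]≡y x e)

    e⇒x≡x : ∀ x → e ⇒ x ≡ x
    e⇒x≡x x = trans (sym (*-identityˡ (e ⇒ x))) (x*[x⇒y]≡y e x)

    isJohnstone : IsJohnstone A
    isJohnstone = x⇒x≡e , e⇒x≡x , λ x y → x*[x⇒y]≡y ((x ⇒ y) ⇒ y) x

    ≤⇒≡ : ∀ {x y} → x ≤ y → x ≡ y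
    ≤⇒≡ {x} {y} x≤y = begin
      x           ≡⟨ *-identityʳ x ⟨
      x * e       ≡⟨ cong (x *_) x≤y ⟨
      x * (x ⇒ y) ≡⟨ x*[x⇒y]≡y x y ⟩
      y           ∎

    residuation⇒isGroup : Residuation A → IsGroupAlg A
    residuation⇒isGroup residuation = _⁻¹ , record
      { isMonoid = isMonoid
      ; inverse  = inverseˡ , inverseʳ
      ; ⁻¹-cong  = cong _⁻¹
      }
      where
      open Residuated isJohnstone residuation using (isMonoid; *-assoc)

      _⁻¹ : X → X
      x ⁻¹ = x ⇒ e

      inverseʳ : ∀ x → x * x ⁻¹ ≡ e
      inverseʳ x = x*[x⇒y]≡y x e

      ⁻¹-involutive : ∀ x → x ⁻¹ ⁻¹ ≡ x
      ⁻¹-involutive x = begin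
        x ⁻¹ ⁻¹              ≡⟨ *-identityˡ (x ⁻¹ ⁻¹) ⟨
        e * x ⁻¹ ⁻¹          ≡⟨ cong (_* x ⁻¹ ⁻¹) (inverseʳ x) ⟨
        (x * x ⁻¹) * x ⁻¹ ⁻¹ ≡⟨ *-assoc x (x ⁻¹) (x ⁻¹ ⁻¹) ⟩
        x * (x ⁻¹ * x ⁻¹ ⁻¹) ≡⟨ cong (x *_) (inverseʳ (x ⁻¹)) ⟩
        x * e                ≡⟨ *-identityʳ x ⟩
        x                    ∎

      inverseˡ : ∀ x → x ⁻¹ * x ≡ e
      inverseˡ x = trans (cong (x ⁻¹ *_) (sym (⁻¹-involutive x))) (inverseʳ (x ⁻¹))

    isGroup⇒residuation : IsGroupAlg A → Residuation A
    isGroup⇒residuation (_ , isGroup) x y z = begin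
      x ⇒ (y ⇒ z)                       ≡⟨ x⇒[x*y]≡y (y * x) (x ⇒ (y ⇒ z)) ⟨
      (y * x) ⇒ ((y * x) * (x ⇒ (y ⇒ z))) ≡⟨ cong ((y * x) ⇒_) y*x*[x⇒[y⇒z]]≡z ⟩
      (y * x) ⇒ z                       ∎
      where
      y*x*[x⇒[y⇒z]]≡z : (y * x) * (x ⇒ (y ⇒ z)) ≡ z
      y*x*[x⇒[y⇒z]]≡z = begin
        (y * x) * (x ⇒ (y ⇒ z)) ≡⟨ IsGroup.assoc isGroup y x (x ⇒ (y ⇒ z)) ⟩
        y * (x * (x ⇒ (y ⇒ z))) ≡⟨ cong (y *_) (x*[x⇒y]≡y x (y ⇒ z)) ⟩
        y * (y ⇒ z)             ≡⟨ x*[x⇒y]≡y y z ⟩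
        z                       ∎

    residuation⇔isGroup : Residuation A ⇔ IsGroupAlg A
    residuation⇔isGroup = mk⇔ residuation⇒isGroup isGroup⇒residuation

    compositionality⇒residuation : Compositionality A → Residuation A
    compositionality⇒residuation compositionality x y z = sym (≤⇒≡ [y*x]⇒z≤x⇒[y⇒z])
      where
      [y*x]⇒z≤x⇒[y⇒z] : (y * x) ⇒ z ≤ x ⇒ (y ⇒ z)
      [y*x]⇒z≤x⇒[y⇒z] = subst (λ u → (y * x) ⇒ z ≤ u ⇒ (y ⇒ z)) (x⇒[x*y]≡y y x)
        (compositionality (y * x) z y)

    residuation⇒compositionality : Residuation A → Compositionality A
    residuation⇒compositionality residuation x y z = begin
      (x ⇒ y) ⇒ ((z ⇒ x) ⇒ (z ⇒ y)) ≡⟨ cong ((x ⇒ y) ⇒_) (residuation (z ⇒ x) z y) ⟩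
      (x ⇒ y) ⇒ ((z * (z ⇒ x)) ⇒ y) ≡⟨ cong (λ u → (x ⇒ y) ⇒ (u ⇒ y)) (x*[x⇒y]≡y z x) ⟩
      (x ⇒ y) ⇒ (x ⇒ y)             ≡⟨ x⇒x≡e (x ⇒ y) ⟩
      e                             ∎

    compositionality⇔residuation : Compositionality A ⇔ Residuation A
    compositionality⇔residuation =
      mk⇔ compositionality⇒residuation residuation⇒compositionality

mainTheorem7 : ∀ {a : Level} (A : Alg a) →
    Part1 A × Part2 A × Part3 A × Part4 A
mainTheorem7 A = part1 , part2 , part3 , part4
  where
  open LeftLoop A using (residuation⇔isGroup; compositionality⇔residuation)

  part1 : Part1 A
  part1 = (λ j r → let open Residuated A j r in
                   Johnstone.isPartialOrder A j ≤-trans , isMonoid)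
        , residuation⇔isGroup

  part2 : Part2 A
  part2 = (λ j c → let open Compositional A j c in
                   Johnstone.isPartialOrder A j ≤-trans , ⇒-monoʳ-≤)
        , λ l → residuation⇔isGroup l ⇔-∘ compositionality⇔residuation l

  part3 : Part3 A
  part3 j r _ = *-⇒-adjoint A r , Residuated.*-monoʳ-≤ A j r

  part4 : Part4 A
  part4 j comm r c = ⇒-exchange , x≤[x⇒y]⇒y , *-monoˡ-≤ , *-monoʳ-≤ , ⇒-antimonoˡ-≤
                   , Compositional.⇒-monoʳ-≤ A j c
    where
    open CommutativeResiduated A j comm r
    open Residuated A j r using (*-monoʳ-≤)
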